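{- Let $G$ be a finite, simple, undirected, connected graph, let $\rho$ be a vertex ordering of $G$, let $\mathcal{A}\in\{\mathrm{GS},\mathrm{BFS},\mathrm{LBFS},\mathrm{MCS},\mathrm{MNS}\}$, and let $\sigma$ be the $\mathcal{A}^+(\rho)$ ordering of $G$. If $u \prec_\sigma v$ and $v \prec_\rho u$, then there is a vertex $x$ with $x \prec_\sigma u$, $xu \in E(G)$ and $xv \notin E(G)$.
   Context: A vertex ordering of $G$ is a bijection $\sigma:\{1,\dots,|V(G)|\}\to V(G)$; $u\prec_\sigma v$ means $\sigma^{ -1}(u)<\sigma^{ -1}(v)$. Label Search with respect to a strict partial order $\prec_{\mathcal A}$ on finite subsets of $\mathbb{N}^+$: every vertex starts with label $\emptyset$; for $i=1,\dots,|V(G)|$, the set Eligible consists of the unnumbered vertices $x$ such that there is no unnumbered $y$ with $\mathrm{label}(x)\prec_{\mathcal A}\mathrm{label}(y)$; some vertex $v$ of Eligible is chosen, $\sigma(i):=v$, and $i$ is added to the label of every unnumbered neighbor of $v$. The searches are: GS (Generic Search): $A\prec B$ iff $A=\emptyset$ and $B\neq\emptyset$; BFS: $A\prec B$ iff ($A=\emptyset$ and $B\ne\emptyset$) or $\min(A)>\min(B)$; LBFS: $A\prec B$ iff $A\subsetneq B$ or $\min(A\setminus B)>\min(B\setminus A)$; MCS: $A\prec B$ iff $|A|<|B|$; MNS: $A\prec B$ iff $A\subsetneq B$. For a search $\mathcal A$ and a vertex ordering $\rho$, $\mathcal{A}^+(\rho)$ is the (unique) ordering obtained by always choosing the vertex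 of Eligible that is leftmost in $\rho$. -}

module Defs where

open import Data.Nat using (ℕ; zero; suc; _<_; _≤_)
import Data.Nat as N
open import Data.Nat.Properties using (_≟_)
open import Data.Fin using (Fin; toℕ)
import Data.Fin as F
open import Data.Fin.Permutation using (Permutation′; _⟨$⟩ʳ_; _⟨$⟩ˡ_)
open import Data.List using (List; []; _∷_; filter; map; length)
open import Data.List.Membership.Propositional using (_∈_; _∉_)
open import Data.List.Membership.DecPropositional _≟_ using (_∈?_)
open import Data.Maybe using (Maybe; just; nothing)
open import Data.Product using (Σ; ∃; _×_; _,_)
open import Data.Sum using (_⊎_)
open import Data.Empty using (⊥)
open import Relation.Nullary using (¬_; Dec; yes; no)
open import Relation.Nullary.Decidable using (¬?)
open import Relation.Unary using (Decidable) renaming (_⊆_ to _⊆ᵘ_)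
open import Relation.Binary using (Rel)
import Relation.Binary as B
open import Relation.Binary.PropositionalEquality using (_≡_; _≢_)
open import Relation.Binary.Construct.Closure.ReflexiveTransitive using (Star)
open import Data.Fin.Properties using (all?)

record Graph (n : ℕ) : Set₁ where
  field
    Adj    : Rel (Fin n) _
    adj?   : B.Decidable Adj
    sym    : ∀ {u v} → Adj u v → Adj v u
    irrefl : ∀ {u} → ¬ Adj u u
open Graph public

Connected : ∀ {n} → Graph n → Set
Connected G = ∀ u v → Star (Adj G) u v

-- Vertex orderings: a bijection σ from positions (Fin n, 0-based; position
-- i corresponds to the paper's index i+1) to vertices.

VertexOrdering : ℕ → Set
VertexOrdering n = Permutation′ n

_≺[_]_ : ∀ {n} → Fin n → VertexOrdering n → Fin n → Set
u ≺[ σ ] v = toℕ (σ ⟨$⟩ˡ u) < toℕ (σ ⟨$⟩ˡ v)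

-- Labels: finite subsets of ℕ⁺, represented as lists of naturals
-- (the lists arising below are duplicate-free and increasing).

Label : Set
Label = List ℕ

_∖_ : Label → Label → Label
A ∖ B = filter (λ k → ¬? (k ∈? B)) A

minL : Label → Maybe ℕ
minL []      = nothing
minL (x ∷ xs) with minL xs
... | nothing = just x
... | just m  = just (x N.⊓ m)

_⊊_ : Label → Label → Set
A ⊊ B = (∀ {k} → k ∈ A → k ∈ B) × ∃ λ k → k ∈ B × k ∉ A

MinGt : Label → Label → Set
MinGt A B = Σ ℕ λ a → Σ ℕ λ b → minL A ≡ just a × minL B ≡ just b × b < a

data Search : Set where
  GS BFS LBFS MCS MNS : Search

_⊰[_]_ : Label → Search → Label → Set
A ⊰[ GS   ] B = A ≡ [] × B ≢ []
A ⊰[ BFS  ] B = (A ≡ [] × B ≢ []) ⊎ MinGt A B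
A ⊰[ LBFS ] B = A ⊊ B ⊎ MinGt (A ∖ B) (B ∖ A)
A ⊰[ MCS  ] B = length A < length B
A ⊰[ MNS  ] B = A ⊊ B

-- At step i (0-based position; paper's step i+1), a vertex x is unnumbered
-- iff its position is ≥ i, and its label is the set of paper-indices j+1
-- (j < i) such that σ(j) is adjacent to x.

allFinL : (n : ℕ) → List (Fin n)
allFinL n = Data.List.tabulate {n = n} (λ i → i)
  where import Data.List

label : ∀ {n} → Graph n → VertexOrdering n → Fin n → Fin n → Label
label G σ i x =
  map (λ j → suc (toℕ j))
      (filter (λ j → (toℕ j N.<? toℕ i) Relation.Nullary.×-dec adj? G (σ ⟨$⟩ʳ j) x)
              (allFinL _))

Unnumbered : ∀ {n} → VertexOrdering n → Fin n → Fin n → Set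
Unnumbered σ i x = toℕ i ≤ toℕ (σ ⟨$⟩ˡ x)

Eligible : ∀ {n} → Search → Graph n → VertexOrdering n → Fin n → Fin n → Set
Eligible 𝒜 G σ i x =
  Unnumbered σ i x ×
  ¬ (∃ λ y → Unnumbered σ i y × (label G σ i x ⊰[ 𝒜 ] label G σ i y))

IsPlusOrdering : ∀ {n} → Search → Graph n → VertexOrdering n → VertexOrdering n → Set
IsPlusOrdering 𝒜 G ρ σ =
  ∀ i → Eligible 𝒜 G σ i (σ ⟨$⟩ʳ i) ×
        (∀ y → Eligible 𝒜 G σ i y → toℕ (ρ ⟨$⟩ˡ (σ ⟨$⟩ʳ i)) ≤ toℕ (ρ ⟨$⟩ˡ y))

-- At the step where σ numbers u, the vertex v is still unnumbered. If every
-- earlier neighbour of u were also a neighbour of v, the label of u would be a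
-- sublist of the label of v, and each of the five label orders is antitone in
-- its left argument along sublists; so v would be eligible together with u,
-- and the 𝒜⁺(ρ) rule would have preferred v, which comes first in ρ.
module Submission where

open import Defs
open import Data.Nat using (_<_; _≤_)
import Data.Nat as ℕ
open import Data.Nat.Properties using (≤-refl; ≤-trans; <-≤-trans; ≤-<-trans; <⇒≤; <⇒≱; m⊓n≤m; m⊓n≤n; ⊓-sel)
import Data.Nat.Properties as ℕₚ
open import Data.Fin using (Fin; toℕ)
open import Data.Fin.Permutation using (_⟨$⟩ʳ_; _⟨$⟩ˡ_; inverseˡ; inverseʳ)
open import Data.Fin.Properties using (any?)
open import Data.List using ([]; _∷_)
open import Data.List.Membership.Propositional using (_∈_; _∉_)
open import Data.List.Membership.Propositional.Properties using (∈-filter⁺; ∈-filter⁻)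
open import Data.List.Membership.DecPropositional ℕₚ._≟_ using (_∈?_)
open import Data.List.Relation.Unary.Any using (here; there)
open import Data.List.Relation.Binary.Subset.Propositional using (_⊆_)
open import Data.List.Relation.Binary.Subset.Propositional.Properties using (filter⁺′)
open import Data.List.Relation.Binary.Sublist.Propositional using ([]; ⊆-refl; lookup) renaming (_⊆_ to _⊑_)
open import Data.List.Relation.Binary.Sublist.Propositional.Properties using (map⁺; filter⁺; length-mono-≤)
open import Data.Maybe using (just; nothing)
open import Data.Product using (∃; _×_; _,_; proj₁; proj₂)
open import Data.Sum using (_⊎_; inj₁; inj₂)
open import Data.Empty using (⊥-elim)
open import Relation.Nullary using (¬_; yes; no; _×-dec_)
open import Relation.Nullary.Decidable using (¬?)
open import Relation.Unary using (Decidable)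
open import Relation.Binary.PropositionalEquality using (_≡_; _≢_; refl; subst) renaming (sym to ≡-sym)

minL-nothing⇒∉ : ∀ {A k} → minL A ≡ nothing → k ∉ A
minL-nothing⇒∉ {x ∷ xs} eq _ with minL xs
minL-nothing⇒∉ {x ∷ xs} () _ | nothing
minL-nothing⇒∉ {x ∷ xs} () _ | just _

minL-∈ : ∀ {A m} → minL A ≡ just m → m ∈ A
minL-∈ {x ∷ xs} eq with minL xs in e
... | nothing with refl ← eq = here refl
... | just m with ⊓-sel x m
...   | inj₁ x⊓m≡x with refl ← eq = here x⊓m≡x
...   | inj₂ x⊓m≡m with refl ← eq = subst (_∈ x ∷ xs) (≡-sym x⊓m≡m) (there (minL-∈ e))

minL-≤ : ∀ {A m k} → minL A ≡ just m → k ∈ A → m ≤ k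
minL-≤ {x ∷ xs} eq k∈A with minL xs in e
minL-≤ {x ∷ xs} refl (here refl)  | nothing = ≤-refl
minL-≤ {x ∷ xs} refl (there k∈xs) | nothing = ⊥-elim (minL-nothing⇒∉ e k∈xs)
minL-≤ {x ∷ xs} refl (here refl)  | just m  = m⊓n≤m x m
minL-≤ {x ∷ xs} refl (there k∈xs) | just m  = ≤-trans (m⊓n≤n x m) (minL-≤ e k∈xs)

minL-just : ∀ {A k} → k ∈ A → ∃ λ m → minL A ≡ just m
minL-just {A} k∈A with minL A in e
... | just m  = m , refl
... | nothing = ⊥-elim (minL-nothing⇒∉ e k∈A)

minL-antitone : ∀ {A B a b} → A ⊆ B → minL A ≡ just a → minL B ≡ just b → b ≤ a
minL-antitone A⊆B minA minB = minL-≤ minB (A⊆B (minL-∈ minA))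

∖-∈ : ∀ {A B k} → k ∈ A → k ∉ B → k ∈ A ∖ B
∖-∈ {B = B} = ∈-filter⁺ (λ k → ¬? (k ∈? B))

∖-∈⁻ : ∀ {A B k} → k ∈ A ∖ B → k ∈ A × k ∉ B
∖-∈⁻ {B = B} = ∈-filter⁻ (λ k → ¬? (k ∈? B))

∖-monoˡ : ∀ {A A′} B → A ⊆ A′ → A ∖ B ⊆ A′ ∖ B
∖-monoˡ B = filter⁺′ (λ k → ¬? (k ∈? B)) (λ k → ¬? (k ∈? B)) (λ k∉B → k∉B)

minL-∖≡nothing⇒⊆ : ∀ {A B} → minL (A ∖ B) ≡ nothing → A ⊆ B
minL-∖≡nothing⇒⊆ {B = B} e {k} k∈A with k ∈? B
... | yes k∈B = k∈B
... | no  k∉B = ⊥-elim (minL-nothing⇒∉ e (∖-∈ k∈A k∉B))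

minL-just⇒≢[] : ∀ {A m} → minL A ≡ just m → A ≢ []
minL-just⇒≢[] () refl

⊊-antitoneˡ : ∀ {A B C} → A ⊆ B → B ⊊ C → A ⊊ C
⊊-antitoneˡ A⊆B (B⊆C , k , k∈C , k∉B) =
  (λ k∈A → B⊆C (A⊆B k∈A)) , k , k∈C , (λ k∈A → k∉B (A⊆B k∈A))

MinGt-antitoneˡ : ∀ {A B C} → A ⊆ B → MinGt B C → A ⊰[ BFS ] C
MinGt-antitoneˡ {[]}    _   (_ , _ , _ , minC , _) = inj₁ (refl , minL-just⇒≢[] minC)
MinGt-antitoneˡ {x ∷ xs} A⊆B (a , b , minB , minC , b<a) with minL-just {x ∷ xs} (here refl)
... | a′ , minA = inj₂ (a′ , b , minA , minC , <-≤-trans b<a (minL-antitone A⊆B minA minB))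

⊆-or-minL-∖ : ∀ A B → A ⊆ B ⊎ ∃ λ m → minL (A ∖ B) ≡ just m
⊆-or-minL-∖ A B with minL (A ∖ B) in e
... | nothing = inj₁ (minL-∖≡nothing⇒⊆ e)
... | just m  = inj₂ (m , refl)

-- The new minimum of C ∖ A is at most the old one, b, and the new minimum of
-- A ∖ C is at least the old one, a.
lexMinGt-antitoneˡ : ∀ {A B C} → A ⊆ B → MinGt (B ∖ C) (C ∖ B) → A ⊰[ LBFS ] C
lexMinGt-antitoneˡ {A} {B} {C} A⊆B (a , b , minBC , minCB , b<a)
  with ∖-∈⁻ {C} {B} (minL-∈ minCB) | ⊆-or-minL-∖ A C
... | b∈C , b∉B | inj₁ A⊆C = inj₁ (A⊆C , b , b∈C , λ b∈A → b∉B (A⊆B b∈A))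
... | b∈C , b∉B | inj₂ (a′ , minAC) =
  let b∈C∖A       = ∖-∈ {C} {A} b∈C (λ b∈A → b∉B (A⊆B b∈A))
      (b′ , minCA) = minL-just b∈C∖A
      a≤a′        = minL-antitone (∖-monoˡ C A⊆B) minAC minBC
  in inj₂ (a′ , b′ , minAC , minCA , ≤-<-trans (minL-≤ minCA b∈C∖A) (<-≤-trans b<a a≤a′))

⊰-antitoneˡ : ∀ 𝒜 {A B C} → A ⊑ B → B ⊰[ 𝒜 ] C → A ⊰[ 𝒜 ] C
⊰-antitoneˡ GS   [] (refl , C≢[])        = refl , C≢[]
⊰-antitoneˡ BFS  [] (inj₁ (refl , C≢[])) = inj₁ (refl , C≢[])
⊰-antitoneˡ BFS  A⊑B (inj₂ B>C) = MinGt-antitoneˡ (lookup A⊑B) B>C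
⊰-antitoneˡ LBFS A⊑B (inj₁ B⊊C) = inj₁ (⊊-antitoneˡ (lookup A⊑B) B⊊C)
⊰-antitoneˡ LBFS A⊑B (inj₂ B>C) = lexMinGt-antitoneˡ (lookup A⊑B) B>C
⊰-antitoneˡ MCS  A⊑B |B|<|C|    = ≤-<-trans (length-mono-≤ A⊑B) |B|<|C|
⊰-antitoneˡ MNS  A⊑B B⊊C        = ⊊-antitoneˡ (lookup A⊑B) B⊊C

label-⊑ : ∀ {n} (G : Graph n) (σ : VertexOrdering n) (i : Fin n) {u v} →
          (∀ j → toℕ j < toℕ i → Adj G (σ ⟨$⟩ʳ j) u → Adj G (σ ⟨$⟩ʳ j) v) →
          label G σ i u ⊑ label G σ i v
label-⊑ G σ i {u} {v} earlier-nbr-u⇒nbr-v =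
  map⁺ (λ j → ℕ.suc (toℕ j))
       (filter⁺ (earlier-nbr? u) (earlier-nbr? v)
                (λ { refl (j<i , adj) → j<i , earlier-nbr-u⇒nbr-v _ j<i adj })
                (⊆-refl {x = allFinL _}))
  where
  earlier-nbr? : ∀ x → Decidable (λ j → toℕ j < toℕ i × Adj G (σ ⟨$⟩ʳ j) x)
  earlier-nbr? x j = (toℕ j ℕ.<? toℕ i) ×-dec adj? G (σ ⟨$⟩ʳ j) x

Eligible-⊑ : ∀ {n 𝒜} {G : Graph n} {σ : VertexOrdering n} {i u v} →
             Eligible 𝒜 G σ i u → Unnumbered σ i v → label G σ i u ⊑ label G σ i v →
             Eligible 𝒜 G σ i v
Eligible-⊑ {𝒜 = 𝒜} (_ , u-maximal) v-unnumbered lu⊑lv =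
  v-unnumbered ,
  λ (y , y-unnumbered , lv≺ly) → u-maximal (y , y-unnumbered , ⊰-antitoneˡ 𝒜 lu⊑lv lv≺ly)

module _ {n 𝒜} (G : Graph n) (ρ σ : VertexOrdering n) (plus : IsPlusOrdering 𝒜 G ρ σ) where

  IsPlusOrdering-eligible : ∀ u → Eligible 𝒜 G σ (σ ⟨$⟩ˡ u) u
  IsPlusOrdering-eligible u =
    subst (Eligible 𝒜 G σ (σ ⟨$⟩ˡ u)) (inverseʳ σ) (proj₁ (plus (σ ⟨$⟩ˡ u)))

  IsPlusOrdering-leftmost : ∀ u v → Eligible 𝒜 G σ (σ ⟨$⟩ˡ u) v → ¬ v ≺[ ρ ] u
  IsPlusOrdering-leftmost u v v-eligible v≺u =
    <⇒≱ v≺u (subst (λ w → toℕ (ρ ⟨$⟩ˡ w) ≤ toℕ (ρ ⟨$⟩ˡ v)) (inverseʳ σ)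
                   (proj₂ (plus (σ ⟨$⟩ˡ u)) v v-eligible))

lemma2 : ∀ {n} (G : Graph n) → Connected G →
         (ρ : VertexOrdering n) (𝒜 : Search) (σ : VertexOrdering n) →
         IsPlusOrdering 𝒜 G ρ σ →
         ∀ u v → u ≺[ σ ] v → v ≺[ ρ ] u →
         ∃ λ x → x ≺[ σ ] u × Adj G x u × ¬ Adj G x v
lemma2 G _ ρ 𝒜 σ plus u v u≺σv v≺ρu
  with any? (λ j → (toℕ j ℕ.<? toℕ (σ ⟨$⟩ˡ u))
                   ×-dec (adj? G (σ ⟨$⟩ʳ j) u ×-dec ¬? (adj? G (σ ⟨$⟩ʳ j) v)))
... | yes (j , j<i , adj-u , ¬adj-v) =
  σ ⟨$⟩ʳ j , subst (λ k → toℕ k < toℕ (σ ⟨$⟩ˡ u)) (≡-sym (inverseˡ σ)) j<i , adj-u , ¬adj-v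
... | no ∄x = ⊥-elim (IsPlusOrdering-leftmost G ρ σ plus u v v-eligible v≺ρu)
  where
  earlier-nbr-u⇒nbr-v : ∀ j → toℕ j < toℕ (σ ⟨$⟩ˡ u) → Adj G (σ ⟨$⟩ʳ j) u → Adj G (σ ⟨$⟩ʳ j) v
  earlier-nbr-u⇒nbr-v j j<i adj-u with adj? G (σ ⟨$⟩ʳ j) v
  ... | yes adj-v  = adj-v
  ... | no  ¬adj-v = ⊥-elim (∄x (j , j<i , adj-u , ¬adj-v))

  v-eligible : Eligible 𝒜 G σ (σ ⟨$⟩ˡ u) v
  v-eligible = Eligible-⊑ {G = G} {σ = σ} (IsPlusOrdering-eligible G ρ σ plus u) (<⇒≤ u≺σv)
                          (label-⊑ G σ (σ ⟨$⟩ˡ u) earlier-nbr-u⇒nbr-v)
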